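{- For all types $\sigma,\tau$: (1) if $\sigma\rightsquigarrow\tau$, then $\sigma\approx_{\mathsf s}\tau$; (2) if $\sigma\Longrightarrow\tau$, then $\sigma\approx_{\mathsf s}\tau$.
   Context: Types: $\sigma ::= \varphi \mid \omega \mid \sigma\to\sigma \mid \sigma\wedge\sigma \mid \sigma\vee\sigma$, $\varphi$ ranging over a denumerable set of atomic types, $\omega$ a further constant. Semantic equivalence $\simeq$ is the least congruence with $\varphi\simeq\omega\to\varphi$, $\omega\simeq\omega\to\omega$, $\sigma\simeq\sigma\wedge\omega$, $\sigma\simeq\omega\wedge\sigma$, $\omega\simeq\sigma\vee\omega$, $\omega\simeq\omega\vee\sigma$. Types are assigned to linear $\lambda$-terms (each free or bound variable occurs exactly once); environments are finite maps from variables to types, $\Gamma_1,\Gamma_2$ denotes union with disjoint domains. Rules: (Ax) $x:\sigma\vdash x:\sigma$; ($\simeq$) from $\Gamma\vdash M:\sigma$, $\sigma\simeq\tau$ infer $\Gamma\vdash M:\tau$; ($\to I$) from $\Gamma,x:\sigma\vdash M:\tau$ infer $\Gamma\vdash\lambda x.M:\sigma\to\tau$; ($\to E$) from $\Gamma_1\vdash M:\sigma\to\tau$, $\Gamma_2\vdash N:\sigma$ infer $\Gamma_1,\Gamma_2\vdash MN:\tau$; ($\wedge I$) from $\Gamma\vdash M:\sigma$, $\Gamma\vdash M:\tau$ infer $\Gamma\vdash M:\sigma\wedge\tau$; ($\wedge E$) from $\Gamma\vdash M:\sigma\wedge\tau$ infer $\Gamma\vdash M:\sigma$ and $\Gamma\vdash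 M:\tau$; ($\vee I$) from $\Gamma\vdash M:\sigma$ infer $\Gamma\vdash M:\sigma\vee\tau$ and $\Gamma\vdash M:\tau\vee\sigma$; ($\vee E$) from $\Gamma_1,x:\sigma\wedge\zeta\vdash M:\rho$, $\Gamma_1,x:\tau\wedge\zeta\vdash M:\rho$, $\Gamma_2\vdash N:(\sigma\vee\tau)\wedge\zeta$ infer $\Gamma_1,\Gamma_2\vdash M[N/x]:\rho$. A finite hereditary identity (FHI) is a $\lambda$-term $\beta$-convertible to $\lambda xy_1\ldots y_n.x(\mathsf{Id}_1y_1)\ldots(\mathsf{Id}_ny_n)$ ($n\ge0$) with $\mathsf{Id}_1,\ldots,\mathsf{Id}_n$ FHIs. $\sigma\approx_{\mathsf s}\tau$ (strongly isomorphic) if there is an FHI $\mathsf{Id}$ with $\vdash\mathsf{Id}:\sigma\to\tau$ and $\vdash\mathsf{Id}:\tau\to\sigma$. The normalisation preorder $\le$ is the least preorder with $\sigma\le\omega$, $\sigma\wedge\tau\le\sigma$, $\sigma\wedge\tau\le\tau$, $\sigma\le\sigma\vee\tau$, $\tau\le\sigma\vee\tau$, ($\sigma\le\tau,\sigma\le\rho\Rightarrow\sigma\le\tau\wedge\rho$), ($\sigma\le\tau,\rho\le\tau\Rightarrow\sigma\vee\rho\le\tau$), $\varphi\le\sigma\to\varphi$, $\omega\le\sigma\to\omega$, ($\sigma'\le\sigma,\tau\le\tau'\Rightarrow\sigma\to\tau\le\sigma'\to\tau'$). The inner normalisation relation $\rightsquigarrow$ consists exactly of: $\omega\to\varphi\rightsquigarrow\varphi$;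 $\sigma\rightsquigarrow\omega$ whenever $\omega\le\sigma$ and $\sigma\ne\omega$; $\sigma\to\tau\wedge\rho\rightsquigarrow(\sigma\to\tau)\wedge(\sigma\to\rho)$; $(\sigma\vee\tau)\wedge\rho\to\zeta\rightsquigarrow(\sigma\wedge\rho)\vee(\tau\wedge\rho)\to\zeta$; $\sigma\vee\tau\to\rho\rightsquigarrow(\sigma\to\rho)\wedge(\tau\to\rho)$; $\sigma\to(\tau\wedge\rho)\vee\zeta\rightsquigarrow\sigma\to(\tau\vee\zeta)\wedge(\rho\vee\zeta)$; $\sigma\wedge\tau\rightsquigarrow\sigma$ and $\sigma\vee\tau\rightsquigarrow\tau$ whenever $\sigma\le\tau$. Type contexts: $C[\,]::=[\,]\mid C[\,]\to\sigma\mid\sigma\to C[\,]\mid\sigma\wedge C[\,]\mid C[\,]\wedge\sigma\mid\sigma\vee C[\,]\mid C[\,]\vee\sigma$. The top normalisation relation $\Longrightarrow$ consists of: $C[\sigma]\Longrightarrow C[\tau]$ whenever $\sigma\rightsquigarrow\tau$; and $(\sigma\wedge\tau)\vee\rho\Longrightarrow(\sigma\vee\rho)\wedge(\tau\vee\rho)$. -}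

module Defs where

open import Data.Nat using (ℕ; _≡ᵇ_)
open import Data.Bool using (if_then_else_)
open import Data.Maybe using (Maybe; just; nothing)
open import Data.Fin using (Fin)
open import Data.Vec using (Vec; []; _∷_; lookup)
open import Data.Product using (Σ; _×_)
open import Relation.Nullary using (¬_)
open import Data.Empty using (⊥)
open import Data.Sum using (_⊎_)
open import Relation.Binary.PropositionalEquality using (_≡_; _≢_)
open import Relation.Binary.Construct.Closure.Equivalence using (EqClosure)

data Ty : Set where
  atom : ℕ → Ty
  ω    : Ty
  _⇒_  : Ty → Ty → Ty
  _∧_  : Ty → Ty → Ty
  _∨_  : Ty → Ty → Ty

infixr 5 _⇒_
infixr 6 _∧_
infixr 6 _∨_

data _≃_ : Ty → Ty → Set where
  ≃-refl  : ∀ {σ} → σ ≃ σ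
  ≃-sym   : ∀ {σ τ} → σ ≃ τ → τ ≃ σ
  ≃-trans : ∀ {σ τ ρ} → σ ≃ τ → τ ≃ ρ → σ ≃ ρ
  ≃-⇒     : ∀ {σ σ' τ τ'} → σ ≃ σ' → τ ≃ τ' → (σ ⇒ τ) ≃ (σ' ⇒ τ')
  ≃-∧     : ∀ {σ σ' τ τ'} → σ ≃ σ' → τ ≃ τ' → (σ ∧ τ) ≃ (σ' ∧ τ')
  ≃-∨     : ∀ {σ σ' τ τ'} → σ ≃ σ' → τ ≃ τ' → (σ ∨ τ) ≃ (σ' ∨ τ')
  ax-φ    : ∀ {a} → atom a ≃ (ω ⇒ atom a)
  ax-ω    : ω ≃ (ω ⇒ ω)
  ax-∧ω   : ∀ {σ} → σ ≃ (σ ∧ ω)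
  ax-ω∧   : ∀ {σ} → σ ≃ (ω ∧ σ)
  ax-∨ω   : ∀ {σ} → ω ≃ (σ ∨ ω)
  ax-ω∨   : ∀ {σ} → ω ≃ (ω ∨ σ)

data Term : Set where
  var : ℕ → Term
  lam : ℕ → Term → Term
  app : Term → Term → Term

data _∈FV_ : ℕ → Term → Set where
  fv-var  : ∀ {x} → x ∈FV var x
  fv-lam  : ∀ {x y M} → x ≢ y → x ∈FV M → x ∈FV lam y M
  fv-appl : ∀ {x M N} → x ∈FV M → x ∈FV app M N
  fv-appr : ∀ {x M N} → x ∈FV N → x ∈FV app M N

data _∈BV_ : ℕ → Term → Set where
  bv-here  : ∀ {x M} → x ∈BV lam x M
  bv-lam   : ∀ {x y M} → x ∈BV M → x ∈BV lam y M
  bv-appl  : ∀ {x M N} → x ∈BV M → x ∈BV app M N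
  bv-appr  : ∀ {x M N} → x ∈BV N → x ∈BV app M N

-- naive substitution M[N/x]; used only under the capture-freeness side
-- condition below (Barendregt convention)
_[_/_] : Term → Term → ℕ → Term
var y   [ N / x ] = if y ≡ᵇ x then N else var y
lam y M [ N / x ] = if y ≡ᵇ x then lam y M else lam y (M [ N / x ])
app M P [ N / x ] = app (M [ N / x ]) (P [ N / x ])

CaptureFree : Term → Term → Set
CaptureFree M N = ∀ y → y ∈BV M → y ∈FV N → ⊥

data _⟶_ : Term → Term → Set where
  β     : ∀ {x P Q} → CaptureFree P Q → app (lam x P) Q ⟶ (P [ Q / x ])
  α     : ∀ {x y P} → ¬ (y ∈FV P) → ¬ (y ∈BV P) →
          lam x P ⟶ lam y (P [ var y / x ])
  ξ-lam : ∀ {x M M'} → M ⟶ M' → lam x M ⟶ lam x M'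
  ξ-appl : ∀ {M M' N} → M ⟶ M' → app M N ⟶ app M' N
  ξ-appr : ∀ {M N N'} → N ⟶ N' → app M N ⟶ app M N'

_=β_ : Term → Term → Set
_=β_ = EqClosure _⟶_

lams : ∀ {n} → Vec ℕ n → Term → Term
lams []       M = M
lams (y ∷ ys) M = lam y (lams ys M)

fhiBody : ∀ {n} → Term → Vec Term n → Vec ℕ n → Term
fhiBody h []         []       = h
fhiBody h (id ∷ ids) (y ∷ ys) = fhiBody (app h (app id (var y))) ids ys

Distinct : ∀ {n} → Vec ℕ n → Set
Distinct vs = ∀ i j → lookup vs i ≡ lookup vs j → i ≡ j

data FHI : Term → Set where
  fhi : ∀ {M} (n x : ℕ) (ys : Vec ℕ n) (ids : Vec Term n) →
        Distinct (x ∷ ys) →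
        (∀ (i : Fin n) → FHI (lookup ids i)) →
        M =β lams (x ∷ ys) (fhiBody (var x) ids ys) →
        FHI M

Env : Set
Env = ℕ → Maybe Ty

∅ : Env
∅ _ = nothing

-- Γ , x : σ   (used only when Γ x ≡ nothing)
_,_∶_ : Env → ℕ → Ty → Env
(Γ , x ∶ σ) y = if y ≡ᵇ x then just σ else Γ y

Union : Env → Env → Env → Set
Union Γ₁ Γ₂ Γ = ∀ y → (Γ₁ y ≡ nothing × Γ y ≡ Γ₂ y) ⊎ (Γ₂ y ≡ nothing × Γ y ≡ Γ₁ y)

data _⊢_∶_ : Env → Term → Ty → Set where
  Ax  : ∀ {Γ x σ} → (∀ y → Γ y ≡ (∅ , x ∶ σ) y) → Γ ⊢ var x ∶ σ
  Eq  : ∀ {Γ M σ τ} → Γ ⊢ M ∶ σ → σ ≃ τ → Γ ⊢ M ∶ τ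
  ⇒I  : ∀ {Γ x M σ τ} → Γ x ≡ nothing → (Γ , x ∶ σ) ⊢ M ∶ τ →
        Γ ⊢ lam x M ∶ (σ ⇒ τ)
  ⇒E  : ∀ {Γ₁ Γ₂ Γ M N σ τ} → Union Γ₁ Γ₂ Γ →
        Γ₁ ⊢ M ∶ (σ ⇒ τ) → Γ₂ ⊢ N ∶ σ → Γ ⊢ app M N ∶ τ
  ∧I  : ∀ {Γ M σ τ} → Γ ⊢ M ∶ σ → Γ ⊢ M ∶ τ → Γ ⊢ M ∶ (σ ∧ τ)
  ∧El : ∀ {Γ M σ τ} → Γ ⊢ M ∶ (σ ∧ τ) → Γ ⊢ M ∶ σ
  ∧Er : ∀ {Γ M σ τ} → Γ ⊢ M ∶ (σ ∧ τ) → Γ ⊢ M ∶ τ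
  ∨Il : ∀ {Γ M σ τ} → Γ ⊢ M ∶ σ → Γ ⊢ M ∶ (σ ∨ τ)
  ∨Ir : ∀ {Γ M σ τ} → Γ ⊢ M ∶ σ → Γ ⊢ M ∶ (τ ∨ σ)
  ∨E  : ∀ {Γ₁ Γ₂ Γ x M N σ τ ζ ρ} → Γ₁ x ≡ nothing → Union Γ₁ Γ₂ Γ →
        CaptureFree M N →
        (Γ₁ , x ∶ (σ ∧ ζ)) ⊢ M ∶ ρ →
        (Γ₁ , x ∶ (τ ∧ ζ)) ⊢ M ∶ ρ →
        Γ₂ ⊢ N ∶ ((σ ∨ τ) ∧ ζ) →
        Γ ⊢ (M [ N / x ]) ∶ ρ

_≈s_ : Ty → Ty → Set
σ ≈s τ = Σ Term λ Id → FHI Id × (∅ ⊢ Id ∶ (σ ⇒ τ)) × (∅ ⊢ Id ∶ (τ ⇒ σ))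

data _≤_ : Ty → Ty → Set where
  ≤-refl  : ∀ {σ} → σ ≤ σ
  ≤-trans : ∀ {σ τ ρ} → σ ≤ τ → τ ≤ ρ → σ ≤ ρ
  ≤-ω     : ∀ {σ} → σ ≤ ω
  ∧≤l     : ∀ {σ τ} → (σ ∧ τ) ≤ σ
  ∧≤r     : ∀ {σ τ} → (σ ∧ τ) ≤ τ
  ≤∨l     : ∀ {σ τ} → σ ≤ (σ ∨ τ)
  ≤∨r     : ∀ {σ τ} → τ ≤ (σ ∨ τ)
  ≤∧      : ∀ {σ τ ρ} → σ ≤ τ → σ ≤ ρ → σ ≤ (τ ∧ ρ)
  ∨≤      : ∀ {σ τ ρ} → σ ≤ τ → ρ ≤ τ → (σ ∨ ρ) ≤ τ
  φ≤      : ∀ {a σ} → atom a ≤ (σ ⇒ atom a)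
  ω≤      : ∀ {σ} → ω ≤ (σ ⇒ ω)
  ⇒≤      : ∀ {σ σ' τ τ'} → σ' ≤ σ → τ ≤ τ' → (σ ⇒ τ) ≤ (σ' ⇒ τ')

data _⇝_ : Ty → Ty → Set where
  r-ωφ  : ∀ {a} → (ω ⇒ atom a) ⇝ atom a
  r-ω   : ∀ {σ} → ω ≤ σ → σ ≢ ω → σ ⇝ ω
  r-⇒∧  : ∀ {σ τ ρ} → (σ ⇒ (τ ∧ ρ)) ⇝ ((σ ⇒ τ) ∧ (σ ⇒ ρ))
  r-∨∧⇒ : ∀ {σ τ ρ ζ} → (((σ ∨ τ) ∧ ρ) ⇒ ζ) ⇝ (((σ ∧ ρ) ∨ (τ ∧ ρ)) ⇒ ζ)
  r-∨⇒  : ∀ {σ τ ρ} → ((σ ∨ τ) ⇒ ρ) ⇝ ((σ ⇒ ρ) ∧ (τ ⇒ ρ))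
  r-⇒∧∨ : ∀ {σ τ ρ ζ} → (σ ⇒ ((τ ∧ ρ) ∨ ζ)) ⇝ (σ ⇒ ((τ ∨ ζ) ∧ (ρ ∨ ζ)))
  r-∧   : ∀ {σ τ} → σ ≤ τ → (σ ∧ τ) ⇝ σ
  r-∨   : ∀ {σ τ} → σ ≤ τ → (σ ∨ τ) ⇝ τ

data Ctx : Set where
  hole : Ctx
  _⇒ᶜ_ : Ctx → Ty → Ctx
  _ᶜ⇒_ : Ty → Ctx → Ctx
  _ᶜ∧_ : Ty → Ctx → Ctx
  _∧ᶜ_ : Ctx → Ty → Ctx
  _ᶜ∨_ : Ty → Ctx → Ctx
  _∨ᶜ_ : Ctx → Ty → Ctx

_⟦_⟧ : Ctx → Ty → Ty
hole     ⟦ σ ⟧ = σ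
(C ⇒ᶜ ρ) ⟦ σ ⟧ = (C ⟦ σ ⟧) ⇒ ρ
(ρ ᶜ⇒ C) ⟦ σ ⟧ = ρ ⇒ (C ⟦ σ ⟧)
(ρ ᶜ∧ C) ⟦ σ ⟧ = ρ ∧ (C ⟦ σ ⟧)
(C ∧ᶜ ρ) ⟦ σ ⟧ = (C ⟦ σ ⟧) ∧ ρ
(ρ ᶜ∨ C) ⟦ σ ⟧ = ρ ∨ (C ⟦ σ ⟧)
(C ∨ᶜ ρ) ⟦ σ ⟧ = (C ⟦ σ ⟧) ∨ ρ

data _⟹_ : Ty → Ty → Set where
  t-ctx  : ∀ {σ τ} (C : Ctx) → σ ⇝ τ → (C ⟦ σ ⟧) ⟹ (C ⟦ τ ⟧)
  t-dist : ∀ {σ τ ρ} → ((σ ∧ τ) ∨ ρ) ⟹ ((σ ∨ ρ) ∧ (τ ∨ ρ))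

module Submission where

-- An FHI λx y₁…yₙ. x (Id₁ y₁) … (Idₙ yₙ) is determined, up to the names of its
-- variables, by its shape, a finite rose tree.  The FHI of a shape has type
-- σ ⇒ τ when η-expanding a variable of type σ along that shape yields type τ.
-- Every rule of a cut-free presentation of ≤ is realised by such an expansion
-- (an arrow rule by one more branch), so by cut elimination every σ ≤ τ is
-- realised; transitivity itself could not be, as two successive expansions do
-- not form a single FHI.  The further inclusions produced by normalisation
-- (distributivity, φ ≃ ω ⇒ φ) are realised as well.  A shape realising an
-- inclusion still does when enlarged, since an FHI of any shape has type ρ ⇒ ρ
-- for every ρ; hence the join of the shapes realising σ ≤ τ and τ ≤ σ gives one
-- FHI of both types σ ⇒ τ and τ ⇒ σ.

open import Defs
open import Data.Product using (_×_; _,_; Σ)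
open import Data.Nat using (ℕ; zero; suc; _+_; _≡ᵇ_; z≤n; s≤s) renaming (_≤_ to _≤ℕ_; _<_ to _<ℕ_)
import Data.Nat.Properties as ℕₚ
open import Data.List using (List; []; _∷_; length)
open import Data.Vec using (Vec; []; _∷_; lookup)
open import Data.Fin using (Fin; zero; suc; toℕ)
open import Data.Fin.Properties using (toℕ-injective)
open import Data.Bool using (true; false; T)
open import Data.Unit using (tt)
open import Data.Maybe using (nothing)
open import Data.Sum using (_⊎_; inj₁; inj₂)
open import Data.Empty using (⊥-elim)
open import Relation.Nullary using (¬_)
open import Relation.Binary.PropositionalEquality using (_≡_; _≢_; refl; sym; trans; cong; cong₂; subst; module ≡-Reasoning)
open import Relation.Binary.Construct.Closure.ReflexiveTransitive using (ε)

variable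
  σ τ ρ ζ σ' τ' ρ' : Ty
  k J L : ℕ
  Γ : Env
  M : Term

≡ᵇ-true⇒≡ : ∀ {m n} → (m ≡ᵇ n) ≡ true → m ≡ n
≡ᵇ-true⇒≡ {m} {n} e = ℕₚ.≡ᵇ⇒≡ m n (subst T (sym e) tt)

≡ᵇ-false⇒≢ : ∀ {m n} → (m ≡ᵇ n) ≡ false → m ≢ n
≡ᵇ-false⇒≢ {m} e refl = subst T e (ℕₚ.≡⇒≡ᵇ m m refl)

data Shape : Set where
  node : List Shape → Shape

consecutive : ℕ → (n : ℕ) → Vec ℕ n
consecutive k zero    = []
consecutive k (suc n) = k ∷ consecutive (suc k) n

mutual
  fhiTerm : ℕ → Shape → Term
  fhiTerm L (node ts) = lam L (expand (suc L) (suc L + length ts) ts (var L))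

  -- λ y₁ … yₙ. H (Id₁ y₁) … (Idₙ yₙ) with yᵢ = k + i − 1, the closed FHIs Idᵢ
  -- binding only variables ≥ J.
  expand : ℕ → ℕ → List Shape → Term → Term
  expand k J ts H = lams (consecutive k (length ts)) (fhiBody H (fhiTerms J ts) (consecutive k (length ts)))

  fhiTerms : ℕ → (ts : List Shape) → Vec Term (length ts)
  fhiTerms J []       = []
  fhiTerms J (t ∷ ts) = fhiTerm J t ∷ fhiTerms J ts

lookup-consecutive : ∀ k n (i : Fin n) → lookup (consecutive k n) i ≡ k + toℕ i
lookup-consecutive k (suc n) zero    = sym (ℕₚ.+-identityʳ k)
lookup-consecutive k (suc n) (suc i) = trans (lookup-consecutive (suc k) n i) (sym (ℕₚ.+-suc k (toℕ i)))

consecutive-distinct : ∀ k n → Distinct (consecutive k n)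
consecutive-distinct k n i j e = toℕ-injective (ℕₚ.+-cancelˡ-≡ k _ _ (begin
  k + toℕ i                  ≡⟨ lookup-consecutive k n i ⟨
  lookup (consecutive k n) i ≡⟨ e ⟩
  lookup (consecutive k n) j ≡⟨ lookup-consecutive k n j ⟩
  k + toℕ j                  ∎))
  where open ≡-Reasoning

mutual
  fhiTerm-FHI : ∀ L t → FHI (fhiTerm L t)
  fhiTerm-FHI L (node ts) =
    fhi (length ts) L (consecutive (suc L) (length ts)) (fhiTerms (suc L + length ts) ts)
        (consecutive-distinct L (suc (length ts))) (fhiTerms-FHI (suc L + length ts) ts) ε

  fhiTerms-FHI : ∀ J ts (i : Fin (length ts)) → FHI (lookup (fhiTerms J ts) i)
  fhiTerms-FHI J (t ∷ ts) zero    = fhiTerm-FHI J t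
  fhiTerms-FHI J (t ∷ ts) (suc i) = fhiTerms-FHI J ts i

mutual
  fhiTerm-closed : ∀ L t y → ¬ y ∈FV fhiTerm L t
  fhiTerm-closed L (node ts) y (fv-lam y≢L p) with expand-∈FV (suc L) _ ts (var L) y p
  ... | fv-var = y≢L refl

  expand-∈FV : ∀ k J ts H y → y ∈FV expand k J ts H → y ∈FV H
  expand-∈FV k J []       H y p = p
  expand-∈FV k J (t ∷ ts) H y (fv-lam y≢k p) with expand-∈FV (suc k) J ts (app H (app (fhiTerm J t) (var k))) y p
  ... | fv-appl q                = q
  ... | fv-appr (fv-appl q)      = ⊥-elim (fhiTerm-closed J t y q)
  ... | fv-appr (fv-appr fv-var) = ⊥-elim (y≢k refl)

mutual
  fhiTerm-∈BV : ∀ L t y → y ∈BV fhiTerm L t → L ≤ℕ y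
  fhiTerm-∈BV L (node ts) .L bv-here = ℕₚ.≤-refl
  fhiTerm-∈BV L (node ts) y (bv-lam p) with expand-∈BV (suc L) (suc L + length ts) ts (var L) y p
  ... | inj₁ ()
  ... | inj₂ (inj₁ L<y) = ℕₚ.<⇒≤ L<y
  ... | inj₂ (inj₂ J≤y) = ℕₚ.≤-trans (ℕₚ.≤-trans (ℕₚ.n≤1+n L) (ℕₚ.m≤m+n (suc L) (length ts))) J≤y

  expand-∈BV : ∀ k J ts H y → y ∈BV expand k J ts H → y ∈BV H ⊎ (k ≤ℕ y ⊎ J ≤ℕ y)
  expand-∈BV k J []       H y p = inj₁ p
  expand-∈BV k J (t ∷ ts) H .k bv-here = inj₂ (inj₁ ℕₚ.≤-refl)
  expand-∈BV k J (t ∷ ts) H y (bv-lam p) with expand-∈BV (suc k) J ts (app H (app (fhiTerm J t) (var k))) y p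
  ... | inj₁ (bv-appl q)             = inj₁ q
  ... | inj₁ (bv-appr (bv-appl q))   = inj₂ (inj₂ (fhiTerm-∈BV J t y q))
  ... | inj₁ (bv-appr (bv-appr ()))
  ... | inj₂ (inj₁ k<y)              = inj₂ (inj₁ (ℕₚ.<⇒≤ k<y))
  ... | inj₂ (inj₂ J≤y)              = inj₂ (inj₂ J≤y)

subst-∉FV : ∀ P N x → ¬ x ∈FV P → (P [ N / x ]) ≡ P
subst-∉FV (var y) N x x∉P with y ≡ᵇ x in e
... | true  = ⊥-elim (x∉P (subst (λ z → x ∈FV var z) (sym (≡ᵇ-true⇒≡ e)) fv-var))
... | false = refl
subst-∉FV (lam y P) N x x∉P with y ≡ᵇ x in e
... | true  = refl
... | false = cong (lam y) (subst-∉FV P N x (λ p → x∉P (fv-lam (λ x≡y → ≡ᵇ-false⇒≢ e (sym x≡y)) p)))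
subst-∉FV (app P Q) N x x∉P =
  cong₂ app (subst-∉FV P N x (λ p → x∉P (fv-appl p))) (subst-∉FV Q N x (λ p → x∉P (fv-appr p)))

subst-var-self : ∀ P x → (P [ var x / x ]) ≡ P
subst-var-self (var y) x with y ≡ᵇ x in e
... | true  = cong var (sym (≡ᵇ-true⇒≡ e))
... | false = refl
subst-var-self (lam y P) x with y ≡ᵇ x
... | true  = refl
... | false = cong (lam y) (subst-var-self P x)
subst-var-self (app P Q) x = cong₂ app (subst-var-self P x) (subst-var-self Q x)

expand-subst₀ : ∀ k J ts H N → (expand (suc k) J ts H [ N / 0 ]) ≡ expand (suc k) J ts (H [ N / 0 ])
expand-subst₀ k J []       H N = refl
expand-subst₀ k J (t ∷ ts) H N = cong (lam (suc k)) (begin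
  expand (suc (suc k)) J ts (app H (app (fhiTerm J t) (var (suc k)))) [ N / 0 ]
    ≡⟨ expand-subst₀ (suc k) J ts _ N ⟩
  expand (suc (suc k)) J ts (app (H [ N / 0 ]) (app (fhiTerm J t [ N / 0 ]) (var (suc k))))
    ≡⟨ cong (λ F → expand (suc (suc k)) J ts (app (H [ N / 0 ]) (app F (var (suc k)))))
            (subst-∉FV (fhiTerm J t) N 0 (fhiTerm-closed J t 0)) ⟩
  expand (suc (suc k)) J ts (app (H [ N / 0 ]) (app (fhiTerm J t) (var (suc k)))) ∎)
  where open ≡-Reasoning

⊢var : ∀ x σ → (∅ , x ∶ σ) ⊢ var x ∶ σ
⊢var x σ = Ax (λ _ → refl)

Union-∅ˡ : Union ∅ Γ Γ
Union-∅ˡ _ = inj₁ (refl , refl)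

Union-extend : Γ k ≡ nothing → Union Γ (∅ , k ∶ σ) (Γ , k ∶ σ)
Union-extend {Γ} {k} Γk≡nothing y with y ≡ᵇ k in e
... | true  = inj₁ (trans (cong Γ (≡ᵇ-true⇒≡ e)) Γk≡nothing , refl)
... | false = inj₂ (refl , refl)

Fresh : ℕ → Env → Set
Fresh k Γ = ∀ y → k ≤ℕ y → Γ y ≡ nothing

Fresh-extend : Fresh k Γ → Fresh (suc k) (Γ , k ∶ σ)
Fresh-extend {k} fr y k<y with y ≡ᵇ k in e
... | true  = ⊥-elim (ℕₚ.<-irrefl (sym (≡ᵇ-true⇒≡ e)) k<y)
... | false = fr y (ℕₚ.<⇒≤ k<y)

Rule : Ty → Ty → Set
Rule σ τ = ∀ {Γ M} → Γ ⊢ M ∶ σ → Γ ⊢ M ∶ τ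

⊢ω : Rule σ ω
⊢ω d = ∧Er (Eq d ax-∧ω)

rule-∨E : Rule (σ ∧ ζ) ρ → Rule (τ ∧ ζ) ρ → Rule ((σ ∨ τ) ∧ ζ) ρ
rule-∨E {σ} {ζ} {ρ} {τ} r₁ r₂ {Γ} d =
  ∨E {Γ₁ = ∅} {Γ₂ = Γ} {x = 0} {σ = σ} {τ = τ} {ζ = ζ}
     refl Union-∅ˡ (λ _ ()) (r₁ (⊢var 0 _)) (r₂ (⊢var 0 _)) d

-- The variables abstracted by the expansion (from k on) and those bound inside
-- its FHIs (from J on) clash with nothing in Γ or M.
record Admissible (k J : ℕ) (ts : List Shape) (Γ : Env) (M : Term) : Set where
  field
    room  : k + length ts ≤ℕ J
    fresh : Fresh k Γ
    fv<   : ∀ y → y ∈FV M → y <ℕ k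
    bv≥   : ∀ y → y ∈BV M → J ≤ℕ y
open Admissible

unbound : ∀ {ts} → Admissible k J ts Γ M → Γ k ≡ nothing
unbound g = fresh g _ ℕₚ.≤-refl

admissible-next : ∀ {t ts} → Admissible k J (t ∷ ts) Γ M →
                  Admissible (suc k) J ts (Γ , k ∶ σ) (app M (app (fhiTerm J t) (var k)))
admissible-next {k} {J} {t = t} {ts} g = record
  { room  = subst (_≤ℕ J) (ℕₚ.+-suc k (length ts)) (room g)
  ; fresh = Fresh-extend (fresh g)
  ; fv<   = fv<′
  ; bv≥   = bv≥′
  }
  where
    fv<′ : ∀ y → y ∈FV app _ (app (fhiTerm J t) (var k)) → y <ℕ suc k
    fv<′ y (fv-appl q)                = ℕₚ.m<n⇒m<1+n (fv< g y q)
    fv<′ y (fv-appr (fv-appl q))      = ⊥-elim (fhiTerm-closed J t y q)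
    fv<′ y (fv-appr (fv-appr fv-var)) = ℕₚ.n<1+n k
    bv≥′ : ∀ y → y ∈BV app _ (app (fhiTerm J t) (var k)) → J ≤ℕ y
    bv≥′ y (bv-appl q)              = bv≥ g y q
    bv≥′ y (bv-appr (bv-appl q))    = fhiTerm-∈BV J t y q
    bv≥′ y (bv-appr (bv-appr ()))

admissible-placeholder : ∀ {ts} → Admissible (suc k) J ts Γ M → Admissible (suc k) J ts (∅ , 0 ∶ σ) (var 0)
admissible-placeholder g = record
  { room  = room g
  ; fresh = λ { (suc y) _ → refl }
  ; fv<   = λ { _ fv-var → s≤s z≤n }
  ; bv≥   = λ _ ()
  }

admissible-root : ∀ L ts → Admissible (suc L) (suc L + length ts) ts (∅ , L ∶ σ) (var L)
admissible-root L ts = record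
  { room  = ℕₚ.≤-refl
  ; fresh = Fresh-extend (λ _ _ → refl)
  ; fv<   = λ { _ fv-var → ℕₚ.n<1+n L }
  ; bv≥   = λ _ ()
  }

-- Variable 0 is never abstracted by an expansion: it is the placeholder that
-- ∨E substitutes in `expands-∨E`.
Expands : Ty → Ty → List Shape → Set
Expands σ τ ts = ∀ {k J Γ M} → Admissible (suc k) J ts Γ M → Γ ⊢ M ∶ σ → Γ ⊢ expand (suc k) J ts M ∶ τ

fhiTerm-⊢ : ∀ {ts} → Expands σ τ ts → ∅ ⊢ fhiTerm L (node ts) ∶ (σ ⇒ τ)
fhiTerm-⊢ {σ} {L = L} {ts} h = ⇒I refl (h (admissible-root L ts) (⊢var L σ))

expands-pre : ∀ {ts} → Rule σ τ → Expands τ ρ ts → Expands σ ρ ts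
expands-pre r h g d = h g (r d)

expands-post : ∀ {ts} → Rule τ ρ → Expands σ τ ts → Expands σ ρ ts
expands-post r h g d = r (h g d)

expands-∧R : ∀ {ts} → Expands σ τ ts → Expands σ ρ ts → Expands σ (τ ∧ ρ) ts
expands-∧R h₁ h₂ g d = ∧I (h₁ g d) (h₂ g d)

expands-∨E : ∀ {ts} → Expands (σ ∧ ζ) ρ ts → Expands (τ ∧ ζ) ρ ts → Expands ((σ ∨ τ) ∧ ζ) ρ ts
expands-∨E {σ} {ζ} {ρ} {τ} {ts} h₁ h₂ {k} {J} {Γ} {M} g d =
  subst (λ P → Γ ⊢ P ∶ ρ) (expand-subst₀ k J ts (var 0) M)
    (∨E {Γ₁ = ∅} {Γ₂ = Γ} {x = 0} {σ = σ} {τ = τ} {ζ = ζ} refl Union-∅ˡ capture-free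
        (h₁ (admissible-placeholder g) (⊢var 0 _)) (h₂ (admissible-placeholder g) (⊢var 0 _)) d)
  where
    capture-free : CaptureFree (expand (suc k) J ts (var 0)) M
    capture-free y y∈BV y∈FV with expand-∈BV (suc k) J ts (var 0) y y∈BV
    ... | inj₁ ()
    ... | inj₂ (inj₁ k<y) = ℕₚ.≤⇒≯ k<y (fv< g y y∈FV)
    ... | inj₂ (inj₂ J≤y) = ℕₚ.≤⇒≯ J≤y
            (ℕₚ.<-≤-trans (fv< g y y∈FV) (ℕₚ.≤-trans (ℕₚ.m≤m+n (suc k) (length ts)) (room g)))

expands-∨L : ∀ {ts} → Expands σ τ ts → Expands ρ τ ts → Expands (σ ∨ ρ) τ ts
expands-∨L h₁ h₂ = expands-pre (λ d → Eq d ax-∧ω) (expands-∨E (expands-pre ∧El h₁) (expands-pre ∧El h₂))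

expands-⇒ : ∀ {cs ts} → Expands σ' σ cs → Expands ρ τ ts → Expands (σ ⇒ ρ) (σ' ⇒ τ) (node cs ∷ ts)
expands-⇒ {σ'} h₁ h₂ {k} g d =
  ⇒I (unbound g) (h₂ (admissible-next g) (⇒E (Union-extend (unbound g)) d (⇒E Union-∅ˡ (fhiTerm-⊢ h₁) (⊢var (suc k) σ'))))

expands-refl : ∀ σ ts → Expands σ σ ts
expands-refl (σ ∧ τ) ts = expands-∧R (expands-pre ∧El (expands-refl σ ts)) (expands-pre ∧Er (expands-refl τ ts))
expands-refl (σ ∨ τ) ts = expands-∨L (expands-post ∨Il (expands-refl σ ts)) (expands-post ∨Ir (expands-refl τ ts))
expands-refl σ [] g d = d
expands-refl ω (node cs ∷ ts) =
  expands-pre (λ d → Eq d ax-ω) (expands-post (λ d → Eq d (≃-sym ax-ω))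
    (expands-⇒ (expands-refl ω cs) (expands-refl ω ts)))
expands-refl (atom a) (node cs ∷ ts) =
  expands-pre (λ d → Eq d ax-φ) (expands-post (λ d → Eq d (≃-sym ax-φ))
    (expands-⇒ (expands-refl ω cs) (expands-refl (atom a) ts)))
expands-refl (σ ⇒ τ) (node cs ∷ ts) = expands-⇒ (expands-refl σ cs) (expands-refl τ ts)

expands-⇒∧ : ∀ {cs ts} → Expands σ' σ cs → Expands τ τ' ts → Expands ρ ρ' ts →
             Expands ((σ ⇒ τ) ∧ (σ ⇒ ρ)) (σ' ⇒ (τ' ∧ ρ')) (node cs ∷ ts)
expands-⇒∧ {σ'} {σ} {cs = cs} h hτ hρ {k} {J} {Γ} g d =
  ⇒I (unbound g) (∧I (hτ (admissible-next g) (⇒E U (∧El d) arg)) (hρ (admissible-next g) (⇒E U (∧Er d) arg)))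
  where
    U : Union Γ (∅ , suc k ∶ σ') (Γ , suc k ∶ σ')
    U = Union-extend (unbound g)
    arg : (∅ , suc k ∶ σ') ⊢ app (fhiTerm J (node cs)) (var (suc k)) ∶ σ
    arg = ⇒E Union-∅ˡ (fhiTerm-⊢ h) (⊢var (suc k) σ')

-- The bound variable of the new abstraction has type σ ∨ τ, so the body is
-- typed by ∨E, substituting that variable for itself.
expands-∨⇒ : ∀ {cs ts} → Expands (σ ∧ ω) σ cs → Expands (τ ∧ ω) τ cs → Expands ρ ρ' ts →
             Expands ((σ ⇒ ρ) ∧ (τ ⇒ ρ)) ((σ ∨ τ) ⇒ ρ') (node cs ∷ ts)
expands-∨⇒ {σ} {τ} {ρ} {ρ'} {cs} {ts} hσ hτ hρ {k} {J} {Γ} {M} g d =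
  Eq (⇒I x-unbound (subst (λ P → (Γ , x ∶ ((σ ∨ τ) ∧ ω)) ⊢ P ∶ ρ') (subst-var-self body x)
       (∨E {Γ₁ = Γ} {Γ₂ = ∅ , x ∶ ((σ ∨ τ) ∧ ω)} {Γ = Γ , x ∶ ((σ ∨ τ) ∧ ω)}
           {x = x} {M = body} {N = var x} {σ = σ} {τ = τ} {ζ = ω}
           x-unbound (Union-extend x-unbound) capture-free
           (branch hσ (∧El d)) (branch hτ (∧Er d)) (⊢var x _))))
     (≃-⇒ (≃-sym ax-∧ω) ≃-refl)
  where
    x : ℕ
    x = suc k
    x-unbound : Γ x ≡ nothing
    x-unbound = unbound g
    H : Term
    H = app M (app (fhiTerm J (node cs)) (var x))
    body : Term
    body = expand (suc x) J ts H
    branch : ∀ {α} → Expands (α ∧ ω) α cs → Γ ⊢ M ∶ (α ⇒ ρ) → (Γ , x ∶ (α ∧ ω)) ⊢ body ∶ ρ'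
    branch hα dα = hρ (admissible-next g) (⇒E (Union-extend x-unbound) dα (⇒E Union-∅ˡ (fhiTerm-⊢ hα) (⊢var x _)))
    x<J : x <ℕ J
    x<J = ℕₚ.<-≤-trans (ℕₚ.m<m+n x (s≤s z≤n)) (room g)
    capture-free : CaptureFree body (var x)
    capture-free y y∈BV fv-var with expand-∈BV (suc x) J ts H x y∈BV
    ... | inj₁ (bv-appl q)           = ℕₚ.≤⇒≯ (bv≥ g x q) x<J
    ... | inj₁ (bv-appr (bv-appl q)) = ℕₚ.≤⇒≯ (fhiTerm-∈BV J (node cs) x q) x<J
    ... | inj₁ (bv-appr (bv-appr ()))
    ... | inj₂ (inj₁ x<x)            = ℕₚ.<-irrefl refl x<x
    ... | inj₂ (inj₂ J≤x)            = ℕₚ.≤⇒≯ J≤x x<J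

infix 4 _⊑_

data _⊑_ : List Shape → List Shape → Set where
  []⊑  : ∀ {cs} → [] ⊑ cs
  node∷⊑ : ∀ {ms ms' cs cs'} → ms ⊑ cs → ms' ⊑ cs' → node ms ∷ ms' ⊑ node cs ∷ cs'

infixr 6 _⊔_

_⊔_ : List Shape → List Shape → List Shape
[]            ⊔ cs            = cs
(m ∷ ms)      ⊔ []            = m ∷ ms
(node m ∷ ms) ⊔ (node c ∷ cs) = node (m ⊔ c) ∷ (ms ⊔ cs)

⊑-refl : ∀ ms → ms ⊑ ms
⊑-refl []            = []⊑
⊑-refl (node m ∷ ms) = node∷⊑ (⊑-refl m) (⊑-refl ms)

⊑-trans : ∀ {ms cs ts} → ms ⊑ cs → cs ⊑ ts → ms ⊑ ts
⊑-trans []⊑            _              = []⊑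
⊑-trans (node∷⊑ p₁ p₂) (node∷⊑ q₁ q₂) = node∷⊑ (⊑-trans p₁ q₁) (⊑-trans p₂ q₂)

ms⊑ms⊔cs : ∀ ms cs → ms ⊑ ms ⊔ cs
ms⊑ms⊔cs []            cs            = []⊑
ms⊑ms⊔cs (m ∷ ms)      []            = ⊑-refl (m ∷ ms)
ms⊑ms⊔cs (node m ∷ ms) (node c ∷ cs) = node∷⊑ (ms⊑ms⊔cs m c) (ms⊑ms⊔cs ms cs)

cs⊑ms⊔cs : ∀ ms cs → cs ⊑ ms ⊔ cs
cs⊑ms⊔cs []            cs            = ⊑-refl cs
cs⊑ms⊔cs (m ∷ ms)      []            = []⊑
cs⊑ms⊔cs (node m ∷ ms) (node c ∷ cs) = node∷⊑ (cs⊑ms⊔cs m c) (cs⊑ms⊔cs ms cs)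

Expandable : Ty → Ty → Set
Expandable σ τ = Σ (List Shape) λ ms → ∀ {ts} → ms ⊑ ts → Expands σ τ ts

expandable₁ : (∀ {ts} → Expands σ τ ts → Expands σ' τ' ts) → Expandable σ τ → Expandable σ' τ'
expandable₁ F (m , h) = m , λ m⊑ts → F (h m⊑ts)

expandable₂ : (∀ {ts} → Expands σ τ ts → Expands σ' τ' ts → Expands ρ ρ' ts) →
              Expandable σ τ → Expandable σ' τ' → Expandable ρ ρ'
expandable₂ F (m₁ , h₁) (m₂ , h₂) =
  m₁ ⊔ m₂ , λ m⊑ts → F (h₁ (⊑-trans (ms⊑ms⊔cs m₁ m₂) m⊑ts)) (h₂ (⊑-trans (cs⊑ms⊔cs m₁ m₂) m⊑ts))

rule⇒expandable : Rule σ τ → Expandable σ τ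
rule⇒expandable {τ = τ} r = [] , λ {ts} _ → expands-pre r (expands-refl τ ts)

expandable-refl : Expandable σ σ
expandable-refl = rule⇒expandable (λ d → d)

expandable-pre : Rule σ τ → Expandable τ ρ → Expandable σ ρ
expandable-pre r = expandable₁ (expands-pre r)

expandable-⇒ : Expandable σ' σ → Expandable ρ τ → Expandable (σ ⇒ ρ) (σ' ⇒ τ)
expandable-⇒ (m₁ , h₁) (m₂ , h₂) = node m₁ ∷ m₂ , λ { (node∷⊑ p₁ p₂) → expands-⇒ (h₁ p₁) (h₂ p₂) }

expandable-⇒∧ : Expandable ((σ ⇒ τ) ∧ (σ ⇒ ρ)) (σ ⇒ (τ ∧ ρ))
expandable-⇒∧ {σ} {τ} {ρ} = node [] ∷ [] , λ { {node cs ∷ ts} (node∷⊑ _ _) →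
  expands-⇒∧ (expands-refl σ cs) (expands-refl τ ts) (expands-refl ρ ts) }

expandable-∨⇒ : Expandable ((σ ⇒ ρ) ∧ (τ ⇒ ρ)) ((σ ∨ τ) ⇒ ρ)
expandable-∨⇒ {σ} {ρ} {τ} = node [] ∷ [] , λ { {node cs ∷ ts} (node∷⊑ _ _) →
  expands-∨⇒ (expands-post ∧El (expands-refl (σ ∧ ω) cs)) (expands-post ∧El (expands-refl (τ ∧ ω) cs))
             (expands-refl ρ ts) }

expandable-post : Rule τ ρ → Expandable σ τ → Expandable σ ρ
expandable-post r = expandable₁ (expands-post r)

expandable-∧ : Expandable σ σ' → Expandable τ τ' → Expandable (σ ∧ τ) (σ' ∧ τ')
expandable-∧ = expandable₂ λ h₁ h₂ → expands-∧R (expands-pre ∧El h₁) (expands-pre ∧Er h₂)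

expandable-∨ : Expandable σ σ' → Expandable τ τ' → Expandable (σ ∨ τ) (σ' ∨ τ')
expandable-∨ = expandable₂ λ h₁ h₂ → expands-∨L (expands-post ∨Il h₁) (expands-post ∨Ir h₂)

infix 4 _≼_

data _≼_ : Ty → Ty → Set where
  ≼-ω      : σ ≼ ω
  ≼-∧R     : σ ≼ τ → σ ≼ ρ → σ ≼ τ ∧ ρ
  ≼-∨L     : σ ≼ τ → ρ ≼ τ → σ ∨ ρ ≼ τ
  ≼-∧L₁    : σ ≼ ρ → σ ∧ τ ≼ ρ
  ≼-∧L₂    : τ ≼ ρ → σ ∧ τ ≼ ρ
  ≼-∨R₁    : σ ≼ τ → σ ≼ τ ∨ ρ
  ≼-∨R₂    : σ ≼ ρ → σ ≼ τ ∨ ρ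
  ≼-atom   : ∀ {a} → atom a ≼ atom a
  ≼-⇒      : σ' ≼ σ → τ ≼ τ' → σ ⇒ τ ≼ σ' ⇒ τ'
  ≼-atom⇒  : ∀ {a} → atom a ≼ τ → atom a ≼ σ ⇒ τ
  ≼-ω⇒     : ω ≼ τ → σ ≼ ρ ⇒ τ

≼-refl : ∀ σ → σ ≼ σ
≼-refl (atom a) = ≼-atom
≼-refl ω        = ≼-ω
≼-refl (σ ⇒ τ)  = ≼-⇒ (≼-refl σ) (≼-refl τ)
≼-refl (σ ∧ τ)  = ≼-∧R (≼-∧L₁ (≼-refl σ)) (≼-∧L₂ (≼-refl τ))
≼-refl (σ ∨ τ)  = ≼-∨L (≼-∨R₁ (≼-refl σ)) (≼-∨R₂ (≼-refl τ))

≼-trans : ∀ τ → σ ≼ τ → τ ≼ ρ → σ ≼ ρ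
≼-trans τ d              ≼-ω            = ≼-ω
≼-trans τ d              (≼-∧R e₁ e₂)   = ≼-∧R (≼-trans τ d e₁) (≼-trans τ d e₂)
≼-trans τ d              (≼-∨R₁ e)      = ≼-∨R₁ (≼-trans τ d e)
≼-trans τ d              (≼-∨R₂ e)      = ≼-∨R₂ (≼-trans τ d e)
≼-trans τ d              (≼-ω⇒ e)       = ≼-ω⇒ e
≼-trans τ (≼-∨L d₁ d₂)   e              = ≼-∨L (≼-trans τ d₁ e) (≼-trans τ d₂ e)
≼-trans τ (≼-∧L₁ d)      e              = ≼-∧L₁ (≼-trans τ d e)
≼-trans τ (≼-∧L₂ d)      e              = ≼-∧L₂ (≼-trans τ d e)
≼-trans (τ₁ ∧ τ₂) (≼-∧R d₁ d₂) (≼-∧L₁ e) = ≼-trans τ₁ d₁ e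
≼-trans (τ₁ ∧ τ₂) (≼-∧R d₁ d₂) (≼-∧L₂ e) = ≼-trans τ₂ d₂ e
≼-trans (τ₁ ∨ τ₂) (≼-∨R₁ d) (≼-∨L e₁ e₂) = ≼-trans τ₁ d e₁
≼-trans (τ₁ ∨ τ₂) (≼-∨R₂ d) (≼-∨L e₁ e₂) = ≼-trans τ₂ d e₂
≼-trans (atom a) ≼-atom e               = e
≼-trans (τ₁ ⇒ τ₂) (≼-⇒ d₁ d₂) (≼-⇒ e₁ e₂) = ≼-⇒ (≼-trans τ₁ e₁ d₁) (≼-trans τ₂ d₂ e₂)
≼-trans (τ₁ ⇒ τ₂) (≼-atom⇒ d) (≼-⇒ e₁ e₂) = ≼-atom⇒ (≼-trans τ₂ d e₂)
≼-trans (τ₁ ⇒ τ₂) (≼-ω⇒ d)    (≼-⇒ e₁ e₂) = ≼-ω⇒ (≼-trans τ₂ d e₂)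

≤⇒≼ : σ ≤ τ → σ ≼ τ
≤⇒≼ ≤-refl                = ≼-refl _
≤⇒≼ (≤-trans {τ = τ} p q) = ≼-trans τ (≤⇒≼ p) (≤⇒≼ q)
≤⇒≼ ≤-ω                   = ≼-ω
≤⇒≼ ∧≤l                   = ≼-∧L₁ (≼-refl _)
≤⇒≼ ∧≤r                   = ≼-∧L₂ (≼-refl _)
≤⇒≼ ≤∨l                   = ≼-∨R₁ (≼-refl _)
≤⇒≼ ≤∨r                   = ≼-∨R₂ (≼-refl _)
≤⇒≼ (≤∧ p q)              = ≼-∧R (≤⇒≼ p) (≤⇒≼ q)
≤⇒≼ (∨≤ p q)              = ≼-∨L (≤⇒≼ p) (≤⇒≼ q)
≤⇒≼ φ≤                    = ≼-atom⇒ ≼-atom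
≤⇒≼ ω≤                    = ≼-ω⇒ ≼-ω
≤⇒≼ (⇒≤ p q)              = ≼-⇒ (≤⇒≼ p) (≤⇒≼ q)

≼⇒expandable : σ ≼ τ → Expandable σ τ
≼⇒expandable ≼-ω          = rule⇒expandable ⊢ω
≼⇒expandable (≼-∧R d e)   = expandable₂ expands-∧R (≼⇒expandable d) (≼⇒expandable e)
≼⇒expandable (≼-∨L d e)   = expandable₂ expands-∨L (≼⇒expandable d) (≼⇒expandable e)
≼⇒expandable (≼-∧L₁ d)    = expandable-pre ∧El (≼⇒expandable d)
≼⇒expandable (≼-∧L₂ d)    = expandable-pre ∧Er (≼⇒expandable d)
≼⇒expandable (≼-∨R₁ d)    = expandable-post ∨Il (≼⇒expandable d)
≼⇒expandable (≼-∨R₂ d)    = expandable-post ∨Ir (≼⇒expandable d)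
≼⇒expandable ≼-atom       = expandable-refl
≼⇒expandable (≼-⇒ d e)    = expandable-⇒ (≼⇒expandable d) (≼⇒expandable e)
≼⇒expandable (≼-atom⇒ d)  =
  expandable-pre (λ e → Eq e ax-φ) (expandable-⇒ (rule⇒expandable ⊢ω) (≼⇒expandable d))
≼⇒expandable (≼-ω⇒ d)     =
  expandable-pre (λ e → Eq (⊢ω e) ax-ω) (expandable-⇒ (rule⇒expandable ⊢ω) (≼⇒expandable d))

≤⇒expandable : σ ≤ τ → Expandable σ τ
≤⇒expandable p = ≼⇒expandable (≤⇒≼ p)

∧-distrib-∨ : Rule ((σ ∨ τ) ∧ ρ) ((σ ∧ ρ) ∨ (τ ∧ ρ))
∧-distrib-∨ = rule-∨E ∨Il ∨Ir

∨-distrib-∧ : Rule ((τ ∨ ζ) ∧ (ρ ∨ ζ)) ((τ ∧ ρ) ∨ ζ)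
∨-distrib-∧ = rule-∨E
  (λ d → rule-∨E (λ e → ∨Il (∧I (∧Er e) (∧El e))) (λ e → ∨Ir (∧El e)) (∧I (∧Er d) (∧El d)))
  (λ d → ∨Ir (∧El d))

Interexpandable : Ty → Ty → Set
Interexpandable σ τ = Expandable σ τ × Expandable τ σ

interexpandable⇒≈s : Interexpandable σ τ → σ ≈s τ
interexpandable⇒≈s ((m₁ , h₁) , (m₂ , h₂)) =
  fhiTerm 0 (node (m₁ ⊔ m₂)) , fhiTerm-FHI 0 (node (m₁ ⊔ m₂)) ,
  fhiTerm-⊢ (h₁ (ms⊑ms⊔cs m₁ m₂)) , fhiTerm-⊢ (h₂ (cs⊑ms⊔cs m₁ m₂))

⇝⇒interexpandable : σ ⇝ τ → Interexpandable σ τ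
⇝⇒interexpandable r-ωφ      = rule⇒expandable (λ d → Eq d (≃-sym ax-φ)) , rule⇒expandable (λ d → Eq d ax-φ)
⇝⇒interexpandable (r-ω p _) = rule⇒expandable ⊢ω , ≤⇒expandable p
⇝⇒interexpandable r-⇒∧      =
  ≤⇒expandable (≤∧ (⇒≤ ≤-refl ∧≤l) (⇒≤ ≤-refl ∧≤r)) , expandable-⇒∧
⇝⇒interexpandable r-∨∧⇒     =
  ≤⇒expandable (⇒≤ (∨≤ (≤∧ (≤-trans ∧≤l ≤∨l) ∧≤r) (≤∧ (≤-trans ∧≤l ≤∨r) ∧≤r)) ≤-refl) ,
  expandable-⇒ (rule⇒expandable ∧-distrib-∨) expandable-refl
⇝⇒interexpandable r-∨⇒      = ≤⇒expandable (≤∧ (⇒≤ ≤∨l ≤-refl) (⇒≤ ≤∨r ≤-refl)) , expandable-∨⇒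
⇝⇒interexpandable r-⇒∧∨     =
  ≤⇒expandable (⇒≤ ≤-refl (∨≤ (≤∧ (≤-trans ∧≤l ≤∨l) (≤-trans ∧≤r ≤∨l)) (≤∧ ≤∨r ≤∨r))) ,
  expandable-⇒ expandable-refl (rule⇒expandable ∨-distrib-∧)
⇝⇒interexpandable (r-∧ p)   = rule⇒expandable ∧El , ≤⇒expandable (≤∧ ≤-refl p)
⇝⇒interexpandable (r-∨ p)   = ≤⇒expandable (∨≤ p ≤-refl) , rule⇒expandable ∨Ir

⟦⟧-interexpandable : ∀ C → Interexpandable σ τ → Interexpandable (C ⟦ σ ⟧) (C ⟦ τ ⟧)
⟦⟧-interexpandable hole     p = p
⟦⟧-interexpandable (C ⇒ᶜ ρ) p with ⟦⟧-interexpandable C p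
... | h , h′ = expandable-⇒ h′ expandable-refl , expandable-⇒ h expandable-refl
⟦⟧-interexpandable (ρ ᶜ⇒ C) p with ⟦⟧-interexpandable C p
... | h , h′ = expandable-⇒ expandable-refl h , expandable-⇒ expandable-refl h′
⟦⟧-interexpandable (ρ ᶜ∧ C) p with ⟦⟧-interexpandable C p
... | h , h′ = expandable-∧ expandable-refl h , expandable-∧ expandable-refl h′
⟦⟧-interexpandable (C ∧ᶜ ρ) p with ⟦⟧-interexpandable C p
... | h , h′ = expandable-∧ h expandable-refl , expandable-∧ h′ expandable-refl
⟦⟧-interexpandable (ρ ᶜ∨ C) p with ⟦⟧-interexpandable C p
... | h , h′ = expandable-∨ expandable-refl h , expandable-∨ expandable-refl h′
⟦⟧-interexpandable (C ∨ᶜ ρ) p with ⟦⟧-interexpandable C p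
... | h , h′ = expandable-∨ h expandable-refl , expandable-∨ h′ expandable-refl

⟹⇒interexpandable : σ ⟹ τ → Interexpandable σ τ
⟹⇒interexpandable (t-ctx C r) = ⟦⟧-interexpandable C (⇝⇒interexpandable r)
⟹⇒interexpandable t-dist      =
  ≤⇒expandable (∨≤ (≤∧ (≤-trans ∧≤l ≤∨l) (≤-trans ∧≤r ≤∨l)) (≤∧ ≤∨r ≤∨r)) , rule⇒expandable ∨-distrib-∧

theorem4p2 : ∀ (σ τ : Ty) → (σ ⇝ τ → σ ≈s τ) × (σ ⟹ τ → σ ≈s τ)
theorem4p2 σ τ = (λ r → interexpandable⇒≈s (⇝⇒interexpandable r)) ,
                 (λ r → interexpandable⇒≈s (⟹⇒interexpandable r))
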